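{- Let $j$ and $n$ be non-negative integers with $j\le n$, and let $\{(s_k),(\sigma_k)\}$, $k=0,1,2,\ldots$, be a binomial-transform pair of the first kind. Then \[ \sum_{k=0}^n(-1)^k\binom{n-j}{k}2^{n-k}s_k=2^j\sum_{k=0}^n\binom{n-j}{k}\sigma_k. \]
   Context: Two sequences $(s_k)_{k\ge0}$ and $(\sigma_k)_{k\ge0}$ of complex numbers form a binomial-transform pair of the first kind if $\sigma_n=\sum_{k=0}^n(-1)^k\binom nk s_k$ for every non-negative integer $n$. $\binom ab=0$ for integers $0\le a<b$. -}

module Defs where

open import Level using (_⊔_)
open import Algebra.Bundles using (CommutativeRing)
open import Data.Nat using (ℕ; zero; suc; _^_; _∸_)
open import Data.Nat.Combinatorics using (_C_)

-- Binomial-transform machinery over an arbitrary commutative ring R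
-- (the paper works over ℂ, which agda-stdlib does not provide).
module BinomialTransform {c ℓ} (R : CommutativeRing c ℓ) where
  open CommutativeRing R

  ι : ℕ → Carrier
  ι zero    = 0#
  ι (suc n) = 1# + ι n

  sgn : ℕ → Carrier
  sgn zero    = 1#
  sgn (suc k) = - sgn k

  sumTo : ℕ → (ℕ → Carrier) → Carrier
  sumTo zero    f = f 0
  sumTo (suc n) f = sumTo n f + f (suc n)

  IsBinomialPair : (ℕ → Carrier) → (ℕ → Carrier) → Set ℓ
  IsBinomialPair s σ = ∀ n → σ n ≈ sumTo n (λ k → sgn k * (ι (n C k) * s k))

module Submission where

-- Write B m f = Σ_{k≤m} C(m,k) f k.  Pascal's rule gives B (m+1) f = B m f + B m (f ∘ suc), and
-- it also shows that (s ∘ suc, k ↦ σ k - σ (k+1)) is again a binomial-transform pair.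
-- Induction on m, generalising over the pair, therefore gives
-- B m σ = Σ_{k≤m} (-1)^k C(m,k) 2^(m-k) s k, which is the case j = 0.  For general j put
-- m = n - j: the terms with k > m vanish, and 2^(n-k) = 2^j 2^(m-k) for k ≤ m.

open import Defs
open import Algebra.Bundles using (CommutativeRing)
open import Data.Nat as ℕ using (ℕ; zero; suc; _^_; _∸_; _≤_; _<_; _≤′_; ≤′-refl; ≤′-step; z≤n; s≤s)
open import Data.Nat.Properties
  using (≤-refl; m≤n⇒m≤1+n; n≤1+n; ≤⇒≤′; ≤′⇒≤; m∸n≤m; +-∸-assoc; m+[n∸m]≡n; ^-distribˡ-+-*)
import Data.Nat.Properties as ℕ
open import Data.Nat.Combinatorics using (_C_; k>n⇒nCk≡0; nCk+nC[k+1]≡[n+1]C[k+1])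
open import Function using (_∘_)
open import Relation.Binary.PropositionalEquality as ≡ using (_≡_)
import Algebra.Properties.Ring as RingProperties
import Algebra.Properties.AbelianGroup as AbelianGroupProperties
import Algebra.Properties.CommutativeSemigroup as CommutativeSemigroupProperties
import Algebra.Properties.Semiring.Mult as SemiringMultProperties
import Relation.Binary.Reasoning.Setoid as SetoidReasoning

2^[n∸k]≡2^j*2^[n∸j∸k] : ∀ {j n k} → j ≤ n → k ≤ n ∸ j → 2 ^ (n ∸ k) ≡ 2 ^ j ℕ.* 2 ^ (n ∸ j ∸ k)
2^[n∸k]≡2^j*2^[n∸j∸k] {j} {n} {k} j≤n k≤n∸j = begin
  2 ^ (n ∸ k)                   ≡⟨ ≡.cong (λ e → 2 ^ (e ∸ k)) (m+[n∸m]≡n j≤n) ⟨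
  2 ^ (j ℕ.+ (n ∸ j) ∸ k)       ≡⟨ ≡.cong (2 ^_) (+-∸-assoc j k≤n∸j) ⟩
  2 ^ (j ℕ.+ (n ∸ j ∸ k))       ≡⟨ ^-distribˡ-+-* 2 j (n ∸ j ∸ k) ⟩
  2 ^ j ℕ.* 2 ^ (n ∸ j ∸ k)     ∎
  where open ≡.≡-Reasoning

module BinomialSums {c ℓ} (R : CommutativeRing c ℓ) where
  open CommutativeRing R
  open BinomialTransform R
  open RingProperties ring using (-‿distribˡ-*; -‿distribʳ-*; -‿+-comm)
  open AbelianGroupProperties +-abelianGroup using (⁻¹-anti-homo‿-; xyx⁻¹≈y)
  open CommutativeSemigroupProperties *-commutativeSemigroup using (x∙yz≈y∙xz)
  open CommutativeSemigroupProperties +-commutativeSemigroup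
    using () renaming (interchange to +-interchange; x∙yz≈y∙xz to x+[y+z]≈y+[x+z])
  open SemiringMultProperties semiring using (_×_; ×-homo-+; ×1-homo-*)
  open SetoidReasoning setoid

  ι≡×1# : ∀ n → ι n ≡ n × 1#
  ι≡×1# zero    = ≡.refl
  ι≡×1# (suc n) = ≡.cong (1# +_) (ι≡×1# n)

  ι-homo-+ : ∀ m n → ι (m ℕ.+ n) ≈ ι m + ι n
  ι-homo-+ m n rewrite ι≡×1# m | ι≡×1# n | ι≡×1# (m ℕ.+ n) = ×-homo-+ 1# m n

  ι-homo-* : ∀ m n → ι (m ℕ.* n) ≈ ι m * ι n
  ι-homo-* m n rewrite ι≡×1# m | ι≡×1# n | ι≡×1# (m ℕ.* n) = ×1-homo-* m n

  ι-pascal : ∀ m k → ι (suc m C suc k) ≈ ι (m C k) + ι (m C suc k)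
  ι-pascal m k = trans (reflexive (≡.cong ι (≡.sym (nCk+nC[k+1]≡[n+1]C[k+1] m k))))
                       (ι-homo-+ (m C k) (m C suc k))

  k>m⇒ι[mCk]*x≈0 : ∀ {m k} x → m < k → ι (m C k) * x ≈ 0#
  k>m⇒ι[mCk]*x≈0 x m<k = trans (*-congʳ (reflexive (≡.cong ι (k>n⇒nCk≡0 m<k)))) (zeroˡ x)

  x-[x-y]≈y : ∀ x y → x - (x - y) ≈ y
  x-[x-y]≈y x y = begin
    x + - (x - y)  ≈⟨ +-congˡ (⁻¹-anti-homo‿- x y) ⟩
    x + (y - x)    ≈⟨ +-assoc x y (- x) ⟨
    x + y - x      ≈⟨ xyx⁻¹≈y x y ⟩
    y              ∎

  sumTo-cong≤ : ∀ n {f g} → (∀ k → k ≤ n → f k ≈ g k) → sumTo n f ≈ sumTo n g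
  sumTo-cong≤ zero    f≈g = f≈g 0 z≤n
  sumTo-cong≤ (suc n) f≈g =
    +-cong (sumTo-cong≤ n (λ k k≤n → f≈g k (m≤n⇒m≤1+n k≤n))) (f≈g (suc n) ≤-refl)

  sumTo-cong : ∀ n {f g} → (∀ k → f k ≈ g k) → sumTo n f ≈ sumTo n g
  sumTo-cong n f≈g = sumTo-cong≤ n (λ k _ → f≈g k)

  sumTo-distrib-+ : ∀ n f g → sumTo n (λ k → f k + g k) ≈ sumTo n f + sumTo n g
  sumTo-distrib-+ zero    f g = refl
  sumTo-distrib-+ (suc n) f g = trans (+-congʳ (sumTo-distrib-+ n f g))
    (+-interchange (sumTo n f) (sumTo n g) (f (suc n)) (g (suc n)))

  -‿distrib-sumTo : ∀ n f → - sumTo n f ≈ sumTo n (λ k → - f k)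
  -‿distrib-sumTo zero    f = refl
  -‿distrib-sumTo (suc n) f =
    trans (sym (-‿+-comm (sumTo n f) (f (suc n)))) (+-congʳ (-‿distrib-sumTo n f))

  *-distribˡ-sumTo : ∀ n x f → x * sumTo n f ≈ sumTo n (λ k → x * f k)
  *-distribˡ-sumTo zero    x f = refl
  *-distribˡ-sumTo (suc n) x f =
    trans (distribˡ x (sumTo n f) (f (suc n))) (+-congʳ (*-distribˡ-sumTo n x f))

  sumTo-head-tail : ∀ n f → sumTo (suc n) f ≈ f 0 + sumTo n (f ∘ suc)
  sumTo-head-tail zero    f = refl
  sumTo-head-tail (suc n) f =
    trans (+-congʳ (sumTo-head-tail n f)) (+-assoc (f 0) (sumTo n (f ∘ suc)) (f (suc (suc n))))

  sumTo-extend : ∀ {m n} f → (∀ k → m < k → f k ≈ 0#) → m ≤ n → sumTo m f ≈ sumTo n f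
  sumTo-extend {m} f vanish m≤n = extend (≤⇒≤′ m≤n)
    where
    extend : ∀ {n} → m ≤′ n → sumTo m f ≈ sumTo n f
    extend ≤′-refl        = refl
    extend (≤′-step {n} m≤′n) = begin
      sumTo m f                ≈⟨ extend m≤′n ⟩
      sumTo n f                ≈⟨ +-identityʳ (sumTo n f) ⟨
      sumTo n f + 0#           ≈⟨ +-congˡ (vanish (suc n) (s≤s (≤′⇒≤ m≤′n))) ⟨
      sumTo n f + f (suc n)    ∎

  binomialSum : ℕ → (ℕ → Carrier) → Carrier
  binomialSum m f = sumTo m (λ k → ι (m C k) * f k)

  binomialSum-cong≤ : ∀ m {f g} → (∀ k → k ≤ m → f k ≈ g k) → binomialSum m f ≈ binomialSum m g
  binomialSum-cong≤ m f≈g = sumTo-cong≤ m (λ k k≤m → *-congˡ (f≈g k k≤m))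

  binomialSum-cong : ∀ m {f g} → (∀ k → f k ≈ g k) → binomialSum m f ≈ binomialSum m g
  binomialSum-cong m f≈g = binomialSum-cong≤ m (λ k _ → f≈g k)

  binomialSum-distrib-+ : ∀ m f g →
    binomialSum m (λ k → f k + g k) ≈ binomialSum m f + binomialSum m g
  binomialSum-distrib-+ m f g =
    trans (sumTo-cong m (λ k → distribˡ (ι (m C k)) (f k) (g k))) (sumTo-distrib-+ m _ _)

  -‿distrib-binomialSum : ∀ m f → - binomialSum m f ≈ binomialSum m (λ k → - f k)
  -‿distrib-binomialSum m f =
    trans (-‿distrib-sumTo m _) (sumTo-cong m (λ k → -‿distribʳ-* (ι (m C k)) (f k)))

  *-distribˡ-binomialSum : ∀ m x f → x * binomialSum m f ≈ binomialSum m (λ k → x * f k)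
  *-distribˡ-binomialSum m x f =
    trans (*-distribˡ-sumTo m x _) (sumTo-cong m (λ k → x∙yz≈y∙xz x (ι (m C k)) (f k)))

  binomialSum-extend : ∀ {m n} f → m ≤ n → binomialSum m f ≈ sumTo n (λ k → ι (m C k) * f k)
  binomialSum-extend f = sumTo-extend _ (λ k m<k → k>m⇒ι[mCk]*x≈0 (f k) m<k)

  binomialSum-pascal : ∀ m f → binomialSum (suc m) f ≈ binomialSum m f + binomialSum m (f ∘ suc)
  binomialSum-pascal m f = begin
    binomialSum (suc m) f
      ≈⟨ sumTo-head-tail m _ ⟩
    ι 1 * f 0 + sumTo m (λ k → ι (suc m C suc k) * f (suc k))
      ≈⟨ +-congˡ (sumTo-cong m (λ k → trans (*-congʳ (ι-pascal m k)) (distribʳ (f (suc k)) _ _))) ⟩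
    ι 1 * f 0 + sumTo m (λ k → ι (m C k) * f (suc k) + ι (m C suc k) * f (suc k))
      ≈⟨ +-congˡ (sumTo-distrib-+ m _ _) ⟩
    ι 1 * f 0 + (binomialSum m (f ∘ suc) + sumTo m (λ k → ι (m C suc k) * f (suc k)))
      ≈⟨ x+[y+z]≈y+[x+z] _ _ _ ⟩
    binomialSum m (f ∘ suc) + (ι 1 * f 0 + sumTo m (λ k → ι (m C suc k) * f (suc k)))
      ≈⟨ +-congˡ (sumTo-head-tail m _) ⟨
    binomialSum m (f ∘ suc) + sumTo (suc m) (λ k → ι (m C k) * f k)
      ≈⟨ +-congˡ (binomialSum-extend f (n≤1+n m)) ⟨
    binomialSum m (f ∘ suc) + binomialSum m f
      ≈⟨ +-comm _ _ ⟩
    binomialSum m f + binomialSum m (f ∘ suc)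
      ∎

  signed : (ℕ → Carrier) → ℕ → Carrier
  signed s k = sgn k * s k

  signed-suc : ∀ s k → signed s (suc k) ≈ - signed (s ∘ suc) k
  signed-suc s k = sym (-‿distribˡ-* (sgn k) (s (suc k)))

  sumTo≈binomialSum-signed : ∀ n s →
    sumTo n (λ k → sgn k * (ι (n C k) * s k)) ≈ binomialSum n (signed s)
  sumTo≈binomialSum-signed n s = sumTo-cong n (λ k → x∙yz≈y∙xz (sgn k) (ι (n C k)) (s k))

  IsBinomialPair-shift : ∀ {s σ} → IsBinomialPair s σ →
    IsBinomialPair (s ∘ suc) (λ k → σ k - σ (suc k))
  IsBinomialPair-shift {s} {σ} pair k = begin
    σ k - σ (suc k)      ≈⟨ +-congˡ (-‿cong σ[k+1]≈σ[k]-X) ⟩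
    σ k - (σ k - X)      ≈⟨ x-[x-y]≈y (σ k) X ⟩
    X                    ≈⟨ sumTo≈binomialSum-signed k (s ∘ suc) ⟨
    sumTo k (λ i → sgn i * (ι (k C i) * s (suc i))) ∎
    where
    X : Carrier
    X = binomialSum k (signed (s ∘ suc))

    transform : ∀ n → σ n ≈ binomialSum n (signed s)
    transform n = trans (pair n) (sumTo≈binomialSum-signed n s)

    σ[k+1]≈σ[k]-X : σ (suc k) ≈ σ k - X
    σ[k+1]≈σ[k]-X = begin
      σ (suc k)                                               ≈⟨ transform (suc k) ⟩
      binomialSum (suc k) (signed s)                          ≈⟨ binomialSum-pascal k (signed s) ⟩
      binomialSum k (signed s) + binomialSum k (signed s ∘ suc)
        ≈⟨ +-cong (sym (transform k)) (binomialSum-cong k (signed-suc s)) ⟩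
      σ k + binomialSum k (λ i → - signed (s ∘ suc) i)        ≈⟨ +-congˡ (-‿distrib-binomialSum k _) ⟨
      σ k - X                                                 ∎

  weightedSum : ℕ → (ℕ → Carrier) → Carrier
  weightedSum m s = binomialSum m (λ k → ι (2 ^ (m ∸ k)) * signed s k)

  weightedSum-suc : ∀ m s →
    weightedSum (suc m) s ≈ weightedSum m s + (weightedSum m s - weightedSum m (s ∘ suc))
  weightedSum-suc m s = begin
    weightedSum (suc m) s
      ≈⟨ binomialSum-pascal m _ ⟩
    binomialSum m (λ k → ι (2 ^ (suc m ∸ k)) * signed s k)
      + binomialSum m (λ k → ι (2 ^ (m ∸ k)) * signed s (suc k))
      ≈⟨ +-cong (binomialSum-cong≤ m doubling) (binomialSum-cong m negation) ⟩
    binomialSum m (λ k → w k + w k)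
      + binomialSum m (λ k → - (ι (2 ^ (m ∸ k)) * signed (s ∘ suc) k))
      ≈⟨ +-cong (binomialSum-distrib-+ m w w) (sym (-‿distrib-binomialSum m _)) ⟩
    weightedSum m s + weightedSum m s - weightedSum m (s ∘ suc)
      ≈⟨ +-assoc _ _ _ ⟩
    weightedSum m s + (weightedSum m s - weightedSum m (s ∘ suc))
      ∎
    where
    w : ℕ → Carrier
    w k = ι (2 ^ (m ∸ k)) * signed s k

    doubling : ∀ k → k ≤ m → ι (2 ^ (suc m ∸ k)) * signed s k ≈ w k + w k
    doubling k k≤m = begin
      ι (2 ^ (suc m ∸ k)) * signed s k         ≡⟨ ≡.cong (λ e → ι (2 ^ e) * signed s k) (+-∸-assoc 1 k≤m) ⟩
      ι (p ℕ.+ (p ℕ.+ 0)) * signed s k         ≡⟨ ≡.cong (λ e → ι (p ℕ.+ e) * signed s k) (ℕ.+-identityʳ p) ⟩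
      ι (p ℕ.+ p) * signed s k                 ≈⟨ *-congʳ (ι-homo-+ p p) ⟩
      (ι p + ι p) * signed s k                 ≈⟨ distribʳ (signed s k) (ι p) (ι p) ⟩
      w k + w k                                ∎
      where
      p : ℕ
      p = 2 ^ (m ∸ k)

    negation : ∀ k → ι (2 ^ (m ∸ k)) * signed s (suc k) ≈ - (ι (2 ^ (m ∸ k)) * signed (s ∘ suc) k)
    negation k = trans (*-congˡ (signed-suc s k)) (sym (-‿distribʳ-* _ _))

  binomialSum≈weightedSum : ∀ m {s σ} → IsBinomialPair s σ → binomialSum m σ ≈ weightedSum m s
  binomialSum≈weightedSum zero    {s} pair = *-congˡ (trans (pair 0) (sumTo≈binomialSum-signed 0 s))
  binomialSum≈weightedSum (suc m) {s} {σ} pair = begin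
    binomialSum (suc m) σ                                  ≈⟨ binomialSum-pascal m σ ⟩
    binomialSum m σ + binomialSum m (σ ∘ suc)
      ≈⟨ +-congˡ (binomialSum-cong m (λ k → sym (x-[x-y]≈y (σ k) (σ (suc k))))) ⟩
    binomialSum m σ + binomialSum m (λ k → σ k - τ k)       ≈⟨ +-congˡ (binomialSum-distrib-+ m σ _) ⟩
    binomialSum m σ + (binomialSum m σ + binomialSum m (λ k → - τ k))
      ≈⟨ +-congˡ (+-congˡ (-‿distrib-binomialSum m τ)) ⟨
    binomialSum m σ + (binomialSum m σ - binomialSum m τ)
      ≈⟨ +-cong IH (+-cong IH (-‿cong (binomialSum≈weightedSum m (IsBinomialPair-shift pair)))) ⟩
    weightedSum m s + (weightedSum m s - weightedSum m (s ∘ suc)) ≈⟨ weightedSum-suc m s ⟨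
    weightedSum (suc m) s                                   ∎
    where
    τ : ℕ → Carrier
    τ k = σ k - σ (suc k)

    IH : binomialSum m σ ≈ weightedSum m s
    IH = binomialSum≈weightedSum m pair

theorem23 : ∀ {c ℓ} (R : CommutativeRing c ℓ) → let open CommutativeRing R in let open BinomialTransform R in
    (j n : ℕ) → j ≤ n → (s σ : ℕ → Carrier) → IsBinomialPair s σ →
    sumTo n (λ k → sgn k * (ι ((n ∸ j) C k) * (ι (2 ^ (n ∸ k)) * s k)))
      ≈ ι (2 ^ j) * sumTo n (λ k → ι ((n ∸ j) C k) * σ k)
theorem23 R j n j≤n s σ pair = begin
  sumTo n (λ k → sgn k * (ι (m C k) * (ι (2 ^ (n ∸ k)) * s k)))
    ≈⟨ sumTo-cong n (λ k → trans (x∙yz≈y∙xz (sgn k) (ι (m C k)) _) (*-congˡ (x∙yz≈y∙xz (sgn k) _ (s k)))) ⟩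
  sumTo n (λ k → ι (m C k) * (ι (2 ^ (n ∸ k)) * signed s k))
    ≈⟨ binomialSum-extend _ (m∸n≤m n j) ⟨
  binomialSum m (λ k → ι (2 ^ (n ∸ k)) * signed s k)
    ≈⟨ binomialSum-cong≤ m (λ k k≤m → trans (*-congʳ (power-split k≤m)) (*-assoc _ _ (signed s k))) ⟩
  binomialSum m (λ k → ι (2 ^ j) * (ι (2 ^ (m ∸ k)) * signed s k))
    ≈⟨ *-distribˡ-binomialSum m (ι (2 ^ j)) _ ⟨
  ι (2 ^ j) * weightedSum m s
    ≈⟨ *-congˡ (binomialSum≈weightedSum m pair) ⟨
  ι (2 ^ j) * binomialSum m σ
    ≈⟨ *-congˡ (binomialSum-extend σ (m∸n≤m n j)) ⟩
  ι (2 ^ j) * sumTo n (λ k → ι (m C k) * σ k)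
    ∎
  where
  open CommutativeRing R
  open BinomialTransform R
  open BinomialSums R
  open CommutativeSemigroupProperties *-commutativeSemigroup using (x∙yz≈y∙xz)
  open SetoidReasoning setoid

  m : ℕ
  m = n ∸ j

  power-split : ∀ {k} → k ≤ m → ι (2 ^ (n ∸ k)) ≈ ι (2 ^ j) * ι (2 ^ (m ∸ k))
  power-split {k} k≤m =
    trans (reflexive (≡.cong ι (2^[n∸k]≡2^j*2^[n∸j∸k] j≤n k≤m))) (ι-homo-* (2 ^ j) (2 ^ (m ∸ k)))
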